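{- For every $k\in(\mathbb N\cup\{\infty\})$ with $k\ge 1$, the graph $$\mathbf\Gamma^k:=\{\{a\}\mid a\in\mathbb Z\}\cup\{\{a,a+l\}\mid a\in\mathbb Z,\ l\in\mathbb N,\ 1\le l\le k\}$$ (viewed as a hypergraph on $\mathbb Z$) is order-friendly.
   Context: For a hypergraph $\mathbf R$ on carrier $R$ (a set $\mathbf R$ of nonempty subsets of $R$ containing all singletons) and $X\subseteq R$, $\mathbf R_X=\{Z\in\mathbf R:Z\subseteq X\}$. $\mathbf R_X$ is connected if there is no partition $X=X_1\sqcup X_2$ into nonempty sets with $\mathbf R_X=\mathbf R_{X_1}\cup\mathbf R_{X_2}$; the connected components of $\mathbf R_X$ (for finite $X$) are the $\mathbf R_{X_i}$ for the unique partition $X=\bigsqcup X_i$ with each $\mathbf R_{X_i}$ connected and $\mathbf R_X=\bigcup\mathbf R_{X_i}$. For $X_1,X_2\subseteq\mathbb Z$, $X_1<X_2$ means $\max X_1<\min X_2$. A hypergraph $\mathbf R$ is order-friendly if $R\subseteq\mathbb Z$ and, for every finite $V\subseteq\mathbb Z$ such that $\mathbf R_V$ is not connected, the connected components $\mathbf R_{V_1},\dots,\mathbf R_{V_p}$ of $\mathbf R_V$ can be indexed so that $V_i<V_{i+1}$ for all $i$. -}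

module Defs where

open import Data.Nat as ℕ using (ℕ)
open import Data.Integer using (ℤ; _+_; +_; _<_)
open import Data.List using (List; []; _∷_)
open import Data.List.Membership.Propositional using (_∈_)
open import Data.List.Relation.Binary.Subset.Propositional using (_⊆_)
open import Data.List.Relation.Binary.Permutation.Propositional using (_↭_)
open import Data.List.Relation.Unary.All using (All)
open import Data.List.Relation.Unary.Any using (Any)
open import Data.List.Relation.Unary.AllPairs using (AllPairs)
open import Data.List.Relation.Unary.Linked using (Linked)
open import Data.Product using (Σ; ∃; _×_)
open import Data.Sum using (_⊎_)
open import Data.Empty using (⊥)
open import Data.Unit using (⊤)
open import Relation.Nullary using (¬_)

-- Finite subsets of ℤ are represented by lists (read as sets: only membership matters).
FinSet : Set
FinSet = List ℤ

_≈ₛ_ : FinSet → FinSet → Set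
A ≈ₛ B = A ⊆ B × B ⊆ A

NonEmpty : FinSet → Set
NonEmpty A = ∃ λ x → x ∈ A

Disjoint : FinSet → FinSet → Set
Disjoint A B = ∀ {x} → x ∈ A → x ∈ B → ⊥

-- A hypergraph on carrier ℤ, given by its (finite) hyperedges, as a predicate on finite sets.
-- (Only hyperedges contained in a finite V ever matter below; those are finite.)
Hypergraph : Set₁
Hypergraph = FinSet → Set

Splits : Hypergraph → FinSet → FinSet → FinSet → Set
Splits R X X₁ X₂ =
  (∀ {x} → x ∈ X → x ∈ X₁ ⊎ x ∈ X₂) × X₁ ⊆ X × X₂ ⊆ X × Disjoint X₁ X₂ ×
  NonEmpty X₁ × NonEmpty X₂ ×
  (∀ Z → R Z → Z ⊆ X → Z ⊆ X₁ ⊎ Z ⊆ X₂)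

Connected : Hypergraph → FinSet → Set
Connected R X = ¬ (Σ FinSet λ X₁ → Σ FinSet λ X₂ → Splits R X X₁ X₂)

Components : Hypergraph → FinSet → List FinSet → Set
Components R X Vs =
  (∀ {x} → x ∈ X → Any (x ∈_) Vs) × All (_⊆ X) Vs × AllPairs Disjoint Vs ×
  All NonEmpty Vs × All (Connected R) Vs ×
  (∀ Z → R Z → Z ⊆ X → Any (Z ⊆_) Vs)

_<ₛ_ : FinSet → FinSet → Set
A <ₛ B = ∀ {x y} → x ∈ A → y ∈ B → x < y

OrderFriendly : Hypergraph → Set
OrderFriendly R =
  (V : FinSet) → ¬ Connected R V →
  (Vs : List FinSet) → Components R V Vs →
  ∃ λ Ws → Vs ↭ Ws × Linked _<ₛ_ Ws

data ℕ∞ : Set where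
  fin : ℕ → ℕ∞
  ∞   : ℕ∞

_≤∞_ : ℕ → ℕ∞ → Set
l ≤∞ fin k = l ℕ.≤ k
l ≤∞ ∞     = ⊤

1≤∞_ : ℕ∞ → Set
1≤∞ k = 1 ≤∞ k

Γ : ℕ∞ → Hypergraph
Γ k Z = (∃ λ a → Z ≈ₛ (a ∷ []))
      ⊎ (∃ λ a → ∃ λ l → 1 ℕ.≤ l × l ≤∞ k × Z ≈ₛ (a ∷ (a + + l) ∷ []))

-- A connected set A cannot surround a point y ∉ A that is joined to no point of A: cutting A at y
-- would separate it, because every edge {a, a + l} of Γᵏ whose span contains y yields the shorter
-- edge {a, y}. Hence two components of Γᵏ restricted to V, having no edge between them, do not
-- interleave, so any two of them are comparable under <ₛ, and insertion sorts the components.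
module Submission where

open import Defs
import Data.Nat as ℕ
import Data.Nat.Properties as ℕP
open import Data.Integer using (ℤ; _+_; +_; _-_; -_; _<_; _≤_; _<?_; ∣_∣)
import Data.Integer.Properties as ℤP
open import Data.Integer.Tactic.RingSolver using (solve-∀)
open import Data.List using ([]; _∷_; filter; head)
open import Data.List.Membership.Propositional using (_∈_; _∉_; find)
open import Data.List.Membership.Propositional.Properties using (∈-filter⁺; ∈-filter⁻)
open import Data.List.Relation.Binary.Subset.Propositional using (_⊆_)
open import Data.List.Relation.Binary.Permutation.Propositional
  using (_↭_; ↭-refl; ↭-prep; ↭-swap; ↭-trans)
open import Data.List.Relation.Binary.Permutation.Propositional.Properties using (All-resp-↭)
open import Data.List.Relation.Unary.All as All using (All; []; _∷_; all?)
open import Data.List.Relation.Unary.All.Properties using (¬All⇒Any¬)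
open import Data.List.Relation.Unary.Any using (here; there)
open import Data.List.Relation.Unary.AllPairs using (AllPairs; []; _∷_)
open import Data.List.Relation.Unary.Linked as Linked using (Linked; []; [-]; _∷_; _∷′_)
open import Data.Maybe using (just)
open import Data.Maybe.Relation.Binary.Connected as Maybe using (just)
open import Data.Product using (∃; _×_; _,_; proj₁; proj₂)
open import Data.Sum using (_⊎_; inj₁; inj₂)
open import Data.Empty using (⊥; ⊥-elim)
open import Function using (_∘_; id)
open import Relation.Nullary using (¬_; yes; no)
open import Relation.Binary.Core using (Rel)
open import Relation.Binary.Definitions using (tri<; tri≈; tri>)
open import Relation.Binary.PropositionalEquality using (_≡_; _≢_; refl; sym; trans; cong; subst; subst₂)

Comparable : ∀ {a r} {A : Set a} → Rel A r → Rel A r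
Comparable _≺_ x y = x ≺ y ⊎ y ≺ x

module _ {a r} {A : Set a} {_≺_ : Rel A r} where

  insert : ∀ x {ys} → All (Comparable _≺_ x) ys → Linked _≺_ ys →
           ∃ λ zs → x ∷ ys ↭ zs × Linked _≺_ zs ×
             (∀ {w} → w ≺ x → Maybe.Connected _≺_ (just w) (head ys) →
                              Maybe.Connected _≺_ (just w) (head zs))
  insert x {[]} [] [] = x ∷ [] , ↭-refl , [-] , λ w≺x _ → just w≺x
  insert x {y ∷ ys} (inj₁ x≺y ∷ _) y∷ys-linked =
    x ∷ y ∷ ys , ↭-refl , x≺y ∷ y∷ys-linked , λ w≺x _ → just w≺x
  insert x {y ∷ ys} (inj₂ y≺x ∷ comparable) y∷ys-linked
    with insert x comparable (Linked.tail y∷ys-linked)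
  ... | zs , x∷ys↭zs , zs-linked , keeps-head =
    y ∷ zs , ↭-trans (↭-swap x y ↭-refl) (↭-prep y x∷ys↭zs) ,
    keeps-head y≺x (Linked.head′ y∷ys-linked) ∷′ zs-linked , λ _ w≺y → w≺y

  -- No transitivity is needed, since Linked only relates neighbours.
  linearise : ∀ {xs} → AllPairs (Comparable _≺_) xs → ∃ λ ys → xs ↭ ys × Linked _≺_ ys
  linearise [] = [] , ↭-refl , []
  linearise {x ∷ _} (comparable ∷ pairs) with linearise pairs
  ... | ys , xs↭ys , ys-linked with insert x (All-resp-↭ xs↭ys comparable) ys-linked
  ...   | zs , x∷ys↭zs , zs-linked , _ = zs , ↭-trans (↭-prep x xs↭ys) x∷ys↭zs , zs-linked

AllPairs-mapWith∈ : ∀ {a r s} {A : Set a} {R : Rel A r} {S : Rel A s} {xs} →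
                    (∀ {x y} → x ∈ xs → y ∈ xs → R x y → S x y) →
                    AllPairs R xs → AllPairs S xs
AllPairs-mapWith∈ f [] = []
AllPairs-mapWith∈ f (rs ∷ pairs) =
  All.tabulate (λ y∈xs → f (here refl) (there y∈xs) (All.lookup rs y∈xs)) ∷
  AllPairs-mapWith∈ (λ x∈xs y∈xs → f (there x∈xs) (there y∈xs)) pairs

sharing-a-point⇒≡ : ∀ {Vs A B x} → AllPairs Disjoint Vs → A ∈ Vs → B ∈ Vs →
                    x ∈ A → x ∈ B → A ≡ B
sharing-a-point⇒≡ (_ ∷ _) (here refl) (here refl) _ _ = refl
sharing-a-point⇒≡ (disjoint ∷ _) (here refl) (there B∈Vs) x∈A x∈B =
  ⊥-elim (All.lookup disjoint B∈Vs x∈A x∈B)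
sharing-a-point⇒≡ (disjoint ∷ _) (there A∈Vs) (here refl) x∈A x∈B =
  ⊥-elim (All.lookup disjoint A∈Vs x∈B x∈A)
sharing-a-point⇒≡ (_ ∷ pairs) (there A∈Vs) (there B∈Vs) x∈A x∈B =
  sharing-a-point⇒≡ pairs A∈Vs B∈Vs x∈A x∈B

pair⊆ : ∀ {a b : ℤ} {S} → a ∈ S → b ∈ S → (a ∷ b ∷ []) ⊆ S
pair⊆ a∈S b∈S (here refl) = a∈S
pair⊆ a∈S b∈S (there (here refl)) = b∈S

InSpan : FinSet → ℤ → Set
InSpan A y = ∃ λ x → ∃ λ x' → x ∈ A × x' ∈ A × x < y × y < x'

OutsideSpan : FinSet → FinSet → Set
OutsideSpan B A = ∀ {y} → y ∈ B → ¬ InSpan A y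

outsideSpan⇒<ₛ : ∀ {A B a₀ b₀} → a₀ ∈ A → b₀ ∈ B → a₀ < b₀ → Disjoint A B →
                 OutsideSpan B A → OutsideSpan A B → A <ₛ B
outsideSpan⇒<ₛ {a₀ = a₀} {b₀} a₀∈A b₀∈B a₀<b₀ disjoint B∌A A∌B {a} {b} a∈A b∈B
  with ℤP.<-cmp a b
... | tri< a<b _ _ = a<b
... | tri≈ _ refl _ = ⊥-elim (disjoint a∈A b∈B)
... | tri> _ _ b<a with ℤP.<-cmp a b₀
...   | tri< a<b₀ _ _ = ⊥-elim (A∌B a∈A (b , b₀ , b∈B , b₀∈B , b<a , a<b₀))
...   | tri≈ _ refl _ = ⊥-elim (disjoint a∈A b₀∈B)
...   | tri> _ _ b₀<a = ⊥-elim (B∌A b₀∈B (a₀ , a , a₀∈A , a∈A , a₀<b₀ , b₀<a))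

outsideSpan⇒comparable : ∀ {A B} → NonEmpty A → NonEmpty B → Disjoint A B →
                         OutsideSpan B A → OutsideSpan A B → Comparable _<ₛ_ A B
outsideSpan⇒comparable (a₀ , a₀∈A) (b₀ , b₀∈B) disjoint B∌A A∌B with ℤP.<-cmp a₀ b₀
... | tri< a₀<b₀ _ _ = inj₁ (outsideSpan⇒<ₛ a₀∈A b₀∈B a₀<b₀ disjoint B∌A A∌B)
... | tri≈ _ refl _ = ⊥-elim (disjoint a₀∈A b₀∈B)
... | tri> _ _ b₀<a₀ =
  inj₂ (outsideSpan⇒<ₛ b₀∈B a₀∈A b₀<a₀ (λ p q → disjoint q p) A∌B B∌A)

SpanAdjacent : Hypergraph → Set
SpanAdjacent R = ∀ {Z y} → R Z → InSpan Z y → ∃ λ z → z ∈ Z × R (z ∷ y ∷ [])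

NonAdjacent : Hypergraph → FinSet → FinSet → Set
NonAdjacent R A B = ∀ {a b} → a ∈ A → b ∈ B → ¬ R (a ∷ b ∷ [])

module _ (R : Hypergraph) where

  NoEdgeAcross : FinSet → ℤ → Set
  NoEdgeAcross A y = ∀ {Z u w} → R Z → Z ⊆ A → u ∈ Z → w ∈ Z → u < y → y < w → ⊥

  splitsAt : ∀ {A y} → y ∉ A → NoEdgeAcross A y → InSpan A y →
             Splits R A (filter (_<? y) A) (filter (y <?_) A)
  splitsAt {A} {y} y∉A no-edge-across (x , x' , x∈A , x'∈A , x<y , y<x') =
    side , proj₁ ∘ below⁻ , proj₁ ∘ above⁻ ,
    (λ z∈below z∈above → ℤP.<-asym (proj₂ (below⁻ z∈below)) (proj₂ (above⁻ z∈above))) ,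
    (x , ∈-filter⁺ (_<? y) x∈A x<y) , (x' , ∈-filter⁺ (y <?_) x'∈A y<x') ,
    one-side
    where
    below⁻ : ∀ {z} → z ∈ filter (_<? y) A → z ∈ A × z < y
    below⁻ = ∈-filter⁻ (_<? y) {xs = A}
    above⁻ : ∀ {z} → z ∈ filter (y <?_) A → z ∈ A × y < z
    above⁻ = ∈-filter⁻ (y <?_) {xs = A}

    side : ∀ {z} → z ∈ A → z ∈ filter (_<? y) A ⊎ z ∈ filter (y <?_) A
    side {z} z∈A with ℤP.<-cmp z y
    ... | tri< z<y _ _ = inj₁ (∈-filter⁺ (_<? y) z∈A z<y)
    ... | tri≈ _ refl _ = ⊥-elim (y∉A z∈A)
    ... | tri> _ _ y<z = inj₂ (∈-filter⁺ (y <?_) z∈A y<z)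

    one-side : ∀ Z → R Z → Z ⊆ A → Z ⊆ filter (_<? y) A ⊎ Z ⊆ filter (y <?_) A
    one-side Z RZ Z⊆A with all? (_<? y) Z
    ... | yes all-below = inj₁ λ u∈Z → ∈-filter⁺ (_<? y) (Z⊆A u∈Z) (All.lookup all-below u∈Z)
    ... | no ¬all-below with find (¬All⇒Any¬ (_<? y) Z ¬all-below)
    ...   | w , w∈Z , w≮y = inj₂ all-above
      where
      y<w : y < w
      y<w with side (Z⊆A w∈Z)
      ... | inj₁ w∈below = ⊥-elim (w≮y (proj₂ (below⁻ w∈below)))
      ... | inj₂ w∈above = proj₂ (above⁻ w∈above)
      all-above : Z ⊆ filter (y <?_) A
      all-above u∈Z with side (Z⊆A u∈Z)
      ... | inj₁ u∈below = ⊥-elim (no-edge-across RZ Z⊆A u∈Z w∈Z (proj₂ (below⁻ u∈below)) y<w)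
      ... | inj₂ u∈above = u∈above

  connected⇒outsideSpan : SpanAdjacent R → ∀ {A B} → Connected R A → Disjoint A B →
                          NonAdjacent R A B → OutsideSpan B A
  connected⇒outsideSpan adjacent {A} connected disjoint nonadjacent {y} y∈B y∈span =
    connected (_ , _ , splitsAt (λ y∈A → disjoint y∈A y∈B) no-edge-across y∈span)
    where
    no-edge-across : NoEdgeAcross A y
    no-edge-across RZ Z⊆A u∈Z w∈Z u<y y<w with adjacent RZ (_ , _ , u∈Z , w∈Z , u<y , y<w)
    ... | z , z∈Z , Rzy = nonadjacent (Z⊆A z∈Z) y∈B Rzy

  components-nonAdjacent : ∀ {V Vs A B} → Components R V Vs → A ∈ Vs → B ∈ Vs →
                           Disjoint A B → NonAdjacent R A B
  components-nonAdjacent {A = A} {B} (_ , within , disjoint , _ , _ , edges-inside)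
    A∈Vs B∈Vs A∩B=∅ {a} {b} a∈A b∈B Rab
    with find (edges-inside _ Rab (pair⊆ (All.lookup within A∈Vs a∈A) (All.lookup within B∈Vs b∈B)))
  ... | C , C∈Vs , ab⊆C = A∩B=∅ a∈A (subst (a ∈_) A≡B a∈A)
    where
    A≡B : A ≡ B
    A≡B = trans (sharing-a-point⇒≡ disjoint A∈Vs C∈Vs a∈A (ab⊆C (here refl)))
                (sym (sharing-a-point⇒≡ disjoint B∈Vs C∈Vs b∈B (ab⊆C (there (here refl)))))

  components-comparable : SpanAdjacent R → ∀ {V Vs} → Components R V Vs →
                          AllPairs (Comparable _<ₛ_) Vs
  components-comparable adjacent {Vs = Vs} components@(_ , _ , disjoint , nonempty , connected , _) =
    AllPairs-mapWith∈ comparable disjoint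
    where
    comparable : ∀ {A B} → A ∈ Vs → B ∈ Vs → Disjoint A B → Comparable _<ₛ_ A B
    comparable {A} {B} A∈Vs B∈Vs A∩B=∅ = outsideSpan⇒comparable
      (All.lookup nonempty A∈Vs) (All.lookup nonempty B∈Vs) A∩B=∅
      (connected⇒outsideSpan adjacent (All.lookup connected A∈Vs) A∩B=∅
        (components-nonAdjacent components A∈Vs B∈Vs A∩B=∅))
      (connected⇒outsideSpan adjacent (All.lookup connected B∈Vs) B∩A=∅
        (components-nonAdjacent components B∈Vs A∈Vs B∩A=∅))
      where
      B∩A=∅ : Disjoint B A
      B∩A=∅ p q = A∩B=∅ q p

≤-≤∞-trans : ∀ {m l} k → m ℕ.≤ l → l ≤∞ k → m ≤∞ k
≤-≤∞-trans (fin k) m≤l l≤k = ℕP.≤-trans m≤l l≤k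
≤-≤∞-trans ∞ _ _ = _

i+[j-i]≡j : ∀ i j → i + (j - i) ≡ j
i+[j-i]≡j = solve-∀

-i+[i+j]≡j : ∀ i j → - i + (i + j) ≡ j
-i+[i+j]≡j = solve-∀

<⇒≡+⁺ : ∀ {a y} → a < y → ∃ λ m → 1 ℕ.≤ m × y ≡ a + + m
<⇒≡+⁺ {a} {y} a<y = ∣ y - a ∣ , ℕP.n≢0⇒n>0 m≢0 , sym a+m≡y
  where
  a+m≡y : a + + ∣ y - a ∣ ≡ y
  a+m≡y = trans (cong (_+_ a) (ℤP.0≤i⇒+∣i∣≡i (ℤP.i≤j⇒0≤j-i (ℤP.<⇒≤ a<y)))) (i+[j-i]≡j a y)
  m≢0 : ∣ y - a ∣ ≢ 0
  m≢0 m≡0 = ℤP.<⇒≢ a<y (trans (sym (ℤP.+-identityʳ a)) (subst (λ m → a + + m ≡ y) m≡0 a+m≡y))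

+-cancelˡ-<⁺ : ∀ a {m l} → a + + m < a + + l → m ℕ.< l
+-cancelˡ-<⁺ a {m} {l} a+m<a+l =
  ℤP.drop‿+<+ (subst₂ _<_ (-i+[i+j]≡j a (+ m)) (-i+[i+j]≡j a (+ l)) (ℤP.+-monoʳ-< (- a) a+m<a+l))

∈-pair-bounds : ∀ {a l x} → x ∈ (a ∷ a + + l ∷ []) → a ≤ x × x ≤ a + + l
∈-pair-bounds {a} {l} (here refl) = ℤP.≤-refl , ℤP.i≤i+j a (+ l)
∈-pair-bounds {a} {l} (there (here refl)) = ℤP.i≤i+j a (+ l) , ℤP.≤-refl

Γ-pair : ∀ k a {m} → 1 ℕ.≤ m → m ≤∞ k → Γ k (a ∷ a + + m ∷ [])
Γ-pair k a {m} 1≤m m≤k = inj₂ (a , m , 1≤m , m≤k , id , id)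

Γ-spanAdjacent : ∀ k → SpanAdjacent (Γ k)
Γ-spanAdjacent k (inj₁ (c , Z⊆c , _)) (_ , _ , x∈Z , x'∈Z , x<y , y<x')
  with Z⊆c x∈Z | Z⊆c x'∈Z
... | here refl | here refl = ⊥-elim (ℤP.<-asym x<y y<x')
Γ-spanAdjacent k (inj₂ (a , l , _ , l≤k , Z⊆pair , pair⊆Z)) (_ , _ , x∈Z , x'∈Z , x<y , y<x')
  with <⇒≡+⁺ (ℤP.≤-<-trans (proj₁ (∈-pair-bounds (Z⊆pair x∈Z))) x<y)
... | m , 1≤m , refl = a , pair⊆Z (here refl) , Γ-pair k a 1≤m (≤-≤∞-trans k (ℕP.<⇒≤ m<l) l≤k)
  where
  m<l : m ℕ.< l
  m<l = +-cancelˡ-<⁺ a (ℤP.<-≤-trans y<x' (proj₂ (∈-pair-bounds (Z⊆pair x'∈Z))))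

proposition4p8 : (k : ℕ∞) → 1≤∞ k → OrderFriendly (Γ k)
proposition4p8 k _ _ _ _ components =
  linearise (components-comparable (Γ k) (Γ-spanAdjacent k) components)
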